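{- Let $G$ be any $M$-out-regular DAG on vertices $v_0,\dots,v_n$, let $A=A(G)$ be its adjacency string, and let $A'$ be obtained from $A$ by the construction described in the context. Then $H_0^{pc}(A')\le H_0^{pc}(A)$.
   Context: A directed (multi)graph $G$ on vertices $v_0,\dots,v_n$ is an $M$-out-regular DAG if it is acyclic, $v_0$ has out-degree $0$, and every $v_t$, $t\ge1$, has out-degree exactly $M$ (parallel edges allowed); $N_{\mathrm{out}}(v_t)$ denotes the multiset of its out-neighbours. The adjacency string $A(G)$ is the concatenation $X_1X_2\cdots X_n$ of blocks, where $X_t$ lists the $M$ out-neighbours of $v_t$ (in some order); thus each vertex $v$ occurs in $A$ exactly $d^{\mathrm{in}}(v)$ times. Construction of $A'$: fix a bijection $\sigma:V(G)\to[0..n]$ with $d^{\mathrm{in}}(u)>d^{\mathrm{in}}(v)\Rightarrow\sigma(u)>\sigma(v)$; for each $t\in[1..n]$ delete from block $X_t$ exactly one occurrence of the out-neighbour $w\in N_{\mathrm{out}}(v_t)$ minimising $\sigma(w)$; $A'$ is the concatenation of the resulting blocks (length $n(M-1)$). For a string $X$ of length $N$, $H_0(X)=\sum_c|X|_c\log_2(N/|X|_c)$ ($|X|_c$ = number of occurrences of $c$, $0\log_2(N/0):=0$), and the per-character entropy is $H_0^{pc}(X)=H_0(X)/N$ (taken to be $0$ for the empty string). -}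

module Defs where

open import Data.Nat using (ℕ; zero; suc; _*_; _^_; _≤_; _<_)
open import Data.Fin using (Fin; toℕ) renaming (zero to fzero; suc to fsuc)
open import Data.Fin.Properties using (_≟_)
open import Data.Fin.Permutation using (Permutation′; _⟨$⟩ʳ_)
open import Data.List using (List; []; _∷_; _++_; length; filter; map; concat; allFin)
open import Data.Nat.ListAction using (product)
open import Data.List.Membership.Propositional using (_∈_)
open import Data.Vec using (Vec; toList)
open import Data.Product using (Σ; _×_)
open import Relation.Nullary using (¬_)
open import Relation.Binary.PropositionalEquality using (_≡_)

-- An M-out-regular (multi)graph on vertices v_0..v_n (= Fin (suc n)):
-- vertex v_0 has no out-edges; for t ∈ Fin n, `out t` is the block
-- X_{t+1} listing the M out-neighbours of v_{t+1} (with multiplicity).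
Blocks : ℕ → ℕ → Set
Blocks n M = Fin n → Vec (Fin (suc n)) M

data Edge {n M : ℕ} (out : Blocks n M) : Fin (suc n) → Fin (suc n) → Set where
  edge : (t : Fin n) (w : Fin (suc n)) → w ∈ toList (out t) → Edge out (fsuc t) w

data Reach⁺ {n M : ℕ} (out : Blocks n M) : Fin (suc n) → Fin (suc n) → Set where
  one  : ∀ {u w} → Edge out u w → Reach⁺ out u w
  more : ∀ {u v w} → Edge out u v → Reach⁺ out v w → Reach⁺ out u w

Acyclic : {n M : ℕ} → Blocks n M → Set
Acyclic {n} out = (u : Fin (suc n)) → ¬ Reach⁺ out u u

adjString : {n M : ℕ} → Blocks n M → List (Fin (suc n))
adjString {n} out = concat (map (λ t → toList (out t)) (allFin n))

count : {k : ℕ} → Fin k → List (Fin k) → ℕ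
count c X = length (filter (c ≟_) X)

indeg : {n M : ℕ} → Blocks n M → Fin (suc n) → ℕ
indeg out v = count v (adjString out)

Respects : {n M : ℕ} → Blocks n M → Permutation′ (suc n) → Set
Respects {n} out σ = (u v : Fin (suc n)) → indeg out v < indeg out u →
  toℕ (σ ⟨$⟩ʳ v) < toℕ (σ ⟨$⟩ʳ u)

DeleteMin : {k : ℕ} → Permutation′ k → List (Fin k) → List (Fin k) → Set
DeleteMin {k} σ X Y =
  Σ (Fin k) λ w → (w ∈ X) ×
    (((x : Fin k) → x ∈ X → toℕ (σ ⟨$⟩ʳ w) ≤ toℕ (σ ⟨$⟩ʳ x)) ×
     Σ (List (Fin k)) λ P → Σ (List (Fin k)) λ S →
       (X ≡ P ++ (w ∷ S)) × (Y ≡ P ++ S))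

-- P(X) = ∏_c |X|_c ^ |X|_c   (so that H_0(X) = N log N − log₂ P(X), N = |X|)
powProd : {k : ℕ} → List (Fin k) → ℕ
powProd {k} X = product (map (λ c → count c X ^ count c X) (allFin k))

-- H_0^{pc}(X) ≤ H_0^{pc}(Y), expressed exactly in integer arithmetic
-- (N = |X|, L = |Y|):
--  * L = 0: H^{pc}(Y) = 0, so the claim is H_0(X) = 0, i.e. N^N ≤ P(X);
--  * L > 0: log N − log P(X)/N ≤ log L − log P(Y)/L, multiplied by N·L
--    and exponentiated: N^{NL} · P(Y)^N ≤ L^{NL} · P(X)^L
--    (for N = 0 both sides are 1, matching H^{pc}(X) = 0).
HpcLe′ : ℕ → ℕ → ℕ → ℕ → Set
HpcLe′ N PX zero    PY = N ^ N ≤ PX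
HpcLe′ N PX (suc l) PY = (N ^ (N * suc l)) * (PY ^ N) ≤ (suc l ^ (N * suc l)) * (PX ^ suc l)

HpcLe : {k : ℕ} → List (Fin k) → List (Fin k) → Set
HpcLe X Y = HpcLe′ (length X) (powProd X) (length Y) (powProd Y)

{-# OPTIONS --safe #-}
-- Let N = |A′|, L = |A| and b(v) = d_in(v) = |A|ᵥ.  Exponentiated, the claim reads
-- N^(NL) P(A)^N ≤ L^(NL) P(A′)^L with P(X) = ∏_c |X|_c^|X|_c, and it factors through
-- Q = ∏_{x ∈ A′} b(x) into two inequalities.
-- (1) N^N Q ≤ L^N P(A′): the entropy of A′ is at most its cross entropy against the letter
--     frequencies of A (Gibbs, or the log-sum inequality).  Peeling off one letter at a time
--     reduces it to two letters, which is weighted AM-GM, which follows from Bernoulli.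
-- (2) P(A)^N ≤ Q^L, since P(A) = ∏_{x ∈ A} b(x): the geometric mean of b over A′ is at least
--     that over A.  Because σ respects in-degrees, each block of A′ is a block of A with a letter
--     of least b removed, removing a minimum cannot lower a geometric mean, and all blocks of A
--     have the same length M.
module Submission where

open import Defs
open import Data.Nat
  using (ℕ; zero; suc; _+_; _*_; _^_; _∸_; _≤_; _<_; z≤n; NonZero; >-nonZero⁻¹)
open import Data.Nat.Properties hiding (_≟_)
open import Data.Nat.ListAction using (sum; product)
open import Data.Nat.ListAction.Properties using (sum-++; product-++; product-↭; product≢0)
open import Data.Nat.Tactic.RingSolver using (solve-∀)
open import Algebra.Properties.CommutativeMonoid.Sum +-0-commutativeMonoid
  using (∑-distrib-+; sum-cong-≗; sum-replicate-zero) renaming (sum to ∑)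
open import Algebra.Properties.CommutativeMonoid.Sum *-1-commutativeMonoid
  using ()
  renaming (sum to ∏; ∑-distrib-+ to ∏-distrib-*; sum-cong-≗ to ∏-cong-≗; sum-replicate-zero to ∏-replicate-one)
open import Data.Fin using (Fin; toℕ) renaming (zero to fzero; suc to fsuc)
open import Data.Fin.Properties using (_≟_)
open import Data.Fin.Permutation using (Permutation′; _⟨$⟩ʳ_)
open import Data.List
  using (List; []; _∷_; [_]; _++_; length; filter; map; concat; replicate; tabulate; allFin)
open import Data.List.Properties
  using (length-++; length-++-sucʳ; length-replicate; length-map; length-tabulate; map-++; map-tabulate; filter-++)
open import Data.List.Membership.Propositional using (_∈_)
open import Data.List.Relation.Unary.All as All using (All; []; _∷_)
open import Data.List.Relation.Unary.All.Properties using () renaming (map⁺ to All-map⁺)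
open import Data.List.Relation.Binary.Permutation.Propositional.Properties
  using (shift; All-resp-↭) renaming (map⁺ to ↭-map⁺)
open import Data.Vec using (toList)
open import Data.Vec.Properties using (length-toList)
open import Data.Product using (_,_)
open import Data.Sum using (inj₁; inj₂)
open import Function using (id; _∘_)
open import Relation.Nullary using (yes; no)
open import Relation.Binary.PropositionalEquality
  using (_≡_; refl; sym; trans; cong; cong₂; subst; subst₂; module ≡-Reasoning)

^-distribʳ-* : ∀ m n o → (m * n) ^ o ≡ m ^ o * n ^ o
^-distribʳ-* m n zero    = refl
^-distribʳ-* m n (suc o) = trans (cong (m * n *_) (^-distribʳ-* m n o)) (swap m n (m ^ o) (n ^ o))
  where
  swap : ∀ a b c d → a * b * (c * d) ≡ a * c * (b * d)
  swap = solve-∀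

n^n≢0 : ∀ n → NonZero (n ^ n)
n^n≢0 zero    = _
n^n≢0 (suc n) = m^n≢0 (suc n) (suc n)

rearrangement : ∀ {a b c d} → a ≤ b → c ≤ d → a * d + b * c ≤ a * c + b * d
rearrangement {a} {b} {c} {d} a≤b c≤d with m≤n⇒∃[o]m+o≡n a≤b | m≤n⇒∃[o]m+o≡n c≤d
... | e , refl | f , refl = ≤-trans (m≤m+n _ (e * f)) (≤-reflexive (expand a c e f))
  where
  expand : ∀ a c e f → a * (c + f) + (a + e) * c + e * f ≡ a * c + (a + e) * (c + f)
  expand = solve-∀

^-rearrangement : ∀ k x y → x ^ k * y + y ^ k * x ≤ x ^ k * x + y ^ k * y
^-rearrangement k x y with ≤-total x y
... | inj₁ x≤y = rearrangement (^-monoˡ-≤ k x≤y) x≤y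
... | inj₂ y≤x = subst₂ _≤_ (+-comm (y ^ k * x) _) (+-comm (y ^ k * y) _)
                    (rearrangement (^-monoˡ-≤ k y≤x) y≤x)

-- Bernoulli's inequality (1 + x) ^ (m + 1) ≥ 1 + (m + 1) x for x ≥ -1, homogenised by v / u = 1 + x.
bernoulli : ∀ m u v → suc m * v * u ^ m ≤ v ^ suc m + m * u ^ suc m
bernoulli zero    u v = ≤-reflexive (base v)
  where
  base : ∀ v → 1 * v * 1 ≡ v * 1 + 0
  base = solve-∀
bernoulli (suc m) u v = begin
  suc (suc m) * v * u ^ suc m                          ≡⟨ split m u v (u ^ m) ⟩
  suc m * v * u ^ m * u + v * u ^ suc m                ≤⟨ +-monoˡ-≤ _ (*-monoˡ-≤ u (bernoulli m u v)) ⟩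
  (v ^ suc m + m * u ^ suc m) * u + v * u ^ suc m      ≡⟨ regroup m u (v ^ suc m) (u ^ suc m) v ⟩
  v ^ suc m * u + u ^ suc m * v + m * (u ^ suc m * u)  ≤⟨ +-monoˡ-≤ _ (^-rearrangement (suc m) v u) ⟩
  v ^ suc m * v + u ^ suc m * u + m * (u ^ suc m * u)  ≡⟨ collect m u v (v ^ suc m) (u ^ suc m) ⟩
  v ^ suc (suc m) + suc m * u ^ suc (suc m)            ∎
  where
  open ≤-Reasoning
  split : ∀ m u v w → suc (suc m) * v * (u * w) ≡ suc m * v * w * u + v * (u * w)
  split = solve-∀
  regroup : ∀ m u V U v → (V + m * U) * u + v * U ≡ V * u + U * v + m * (U * u)
  regroup = solve-∀
  collect : ∀ m u v V U → V * v + U * u + m * (U * u) ≡ v * V + suc m * (u * U)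
  collect = solve-∀

-- AM-GM for p and m copies of T / m: Bernoulli's inequality for the ratio m (p + T) / ((m + 1) T).
amgm-step : ∀ m p T → suc m ^ suc m * (p * T ^ m) ≤ m ^ m * (p + T) ^ suc m
amgm-step zero      p T = *-monoʳ-≤ 1 (*-monoˡ-≤ 1 (m≤m+n p T))
amgm-step m@(suc _) p T = *-cancelˡ-≤ m (begin
  m * (suc m ^ suc m * (p * T ^ m))   ≡⟨ regroup m p (suc m ^ m) (T ^ m) ⟩
  suc m * m * p * (suc m ^ m * T ^ m) ≡⟨ cong (suc m * m * p *_) (^-distribʳ-* (suc m) T m) ⟨
  suc m * m * p * U ^ m               ≤⟨ tangent ⟩
  V ^ suc m                           ≡⟨ ^-distribʳ-* m (p + T) (suc m) ⟩
  m ^ suc m * (p + T) ^ suc m         ≡⟨ *-assoc m (m ^ m) _ ⟩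
  m * (m ^ m * (p + T) ^ suc m)       ∎)
  where
  open ≤-Reasoning
  U = suc m * T
  V = m * (p + T)
  regroup : ∀ m p S t → m * (suc m * S * (p * t)) ≡ suc m * m * p * (S * t)
  regroup = solve-∀
  split : ∀ m p T W → suc m * (m * (p + T)) * W ≡ suc m * m * p * W + m * (suc m * T * W)
  split = solve-∀
  tangent : suc m * m * p * U ^ m ≤ V ^ suc m
  tangent = +-cancelʳ-≤ _ _ _ (subst (_≤ V ^ suc m + m * U ^ suc m) (split m p T (U ^ m)) (bernoulli m U V))

amgm : ∀ xs → length xs ^ length xs * product xs ≤ sum xs ^ length xs
amgm []       = ≤-refl
amgm (x ∷ xs) = *-cancelˡ-≤ (m ^ m) {{n^n≢0 m}} (begin
  m ^ m * (suc m ^ suc m * (x * product xs)) ≡⟨ regroup (m ^ m) (suc m ^ suc m) x (product xs) ⟩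
  suc m ^ suc m * x * (m ^ m * product xs)   ≤⟨ *-monoʳ-≤ (suc m ^ suc m * x) (amgm xs) ⟩
  suc m ^ suc m * x * sum xs ^ m             ≡⟨ *-assoc (suc m ^ suc m) x _ ⟩
  suc m ^ suc m * (x * sum xs ^ m)           ≤⟨ amgm-step m x (sum xs) ⟩
  m ^ m * (x + sum xs) ^ suc m               ∎)
  where
  open ≤-Reasoning
  m = length xs
  regroup : ∀ a b x r → a * (b * (x * r)) ≡ b * x * (a * r)
  regroup = solve-∀

sum-replicate : ∀ n x → sum (replicate n x) ≡ n * x
sum-replicate zero    x = refl
sum-replicate (suc n) x = cong (x +_) (sum-replicate n x)

product-replicate : ∀ n x → product (replicate n x) ≡ x ^ n
product-replicate zero    x = refl
product-replicate (suc n) x = cong (x *_) (product-replicate n x)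

weighted-amgm : ∀ i j p q → (i + j) ^ (i + j) * (p ^ i * q ^ j) ≤ (i * p + j * q) ^ (i + j)
weighted-amgm i j p q =
  subst₂ _≤_ (cong₂ (λ n π → n ^ n * π) length-xs product-xs) (cong₂ _^_ sum-xs length-xs) (amgm xs)
  where
  xs = replicate i p ++ replicate j q
  length-xs : length xs ≡ i + j
  length-xs = trans (length-++ (replicate i p)) (cong₂ _+_ (length-replicate i) (length-replicate j))
  product-xs : product xs ≡ p ^ i * q ^ j
  product-xs = trans (product-++ (replicate i p) _) (cong₂ _*_ (product-replicate i p) (product-replicate j q))
  sum-xs : sum xs ≡ i * p + j * q
  sum-xs = trans (sum-++ (replicate i p) _) (cong₂ _+_ (sum-replicate i p) (sum-replicate j q))

log-sum₂ : ∀ a A b B → (a + A) ^ (a + A) * (b ^ a * B ^ A) ≤ a ^ a * A ^ A * (b + B) ^ (a + A)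
log-sum₂ zero A b B = begin
  A ^ A * (1 * B ^ A)          ≡⟨ cong (A ^ A *_) (*-identityˡ (B ^ A)) ⟩
  A ^ A * B ^ A                ≤⟨ *-monoʳ-≤ (A ^ A) (^-monoˡ-≤ A (m≤n+m B b)) ⟩
  A ^ A * (b + B) ^ A          ≡⟨ cong (_* (b + B) ^ A) (*-identityˡ (A ^ A)) ⟨
  1 * A ^ A * (b + B) ^ A      ∎
  where open ≤-Reasoning
log-sum₂ a zero b B rewrite +-identityʳ a = begin
  a ^ a * (b ^ a * 1)          ≡⟨ regroup (a ^ a) (b ^ a) ⟩
  a ^ a * 1 * b ^ a            ≤⟨ *-monoʳ-≤ (a ^ a * 1) (^-monoˡ-≤ a (m≤m+n b B)) ⟩
  a ^ a * 1 * (b + B) ^ a      ∎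
  where
  open ≤-Reasoning
  regroup : ∀ x y → x * (y * 1) ≡ x * 1 * y
  regroup = solve-∀
log-sum₂ a@(suc _) A@(suc _) b B = *-cancelˡ-≤ (a ^ A * A ^ a) {{a^A*A^a≢0}} (begin
  a ^ A * A ^ a * (n ^ n * (b ^ a * B ^ A))       ≡⟨ regroup₁ (a ^ A) (A ^ a) (n ^ n) (b ^ a) (B ^ A) ⟩
  n ^ n * ((b ^ a * A ^ a) * (B ^ A * a ^ A))
    ≡⟨ cong₂ (λ x y → n ^ n * (x * y)) (^-distribʳ-* b A a) (^-distribʳ-* B a A) ⟨
  n ^ n * ((b * A) ^ a * (B * a) ^ A)             ≤⟨ weighted-amgm a A (b * A) (B * a) ⟩
  (a * (b * A) + A * (B * a)) ^ n                 ≡⟨ cong (_^ n) (regroup₂ a A b B) ⟩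
  (a * A * (b + B)) ^ n                           ≡⟨ ^-distribʳ-* (a * A) (b + B) n ⟩
  (a * A) ^ n * (b + B) ^ n                       ≡⟨ cong (_* (b + B) ^ n) (^-distribʳ-* a A n) ⟩
  a ^ n * A ^ n * (b + B) ^ n
    ≡⟨ cong₂ (λ x y → x * y * (b + B) ^ n) (^-distribˡ-+-* a a A) (^-distribˡ-+-* A a A) ⟩
  a ^ a * a ^ A * (A ^ a * A ^ A) * (b + B) ^ n   ≡⟨ regroup₃ (a ^ a) (a ^ A) (A ^ a) (A ^ A) ((b + B) ^ n) ⟩
  a ^ A * A ^ a * (a ^ a * A ^ A * (b + B) ^ n)   ∎)
  where
  open ≤-Reasoning
  n = a + A
  a^A*A^a≢0 : NonZero (a ^ A * A ^ a)
  a^A*A^a≢0 = m*n≢0 (a ^ A) (A ^ a) {{m^n≢0 a A}} {{m^n≢0 A a}}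
  regroup₁ : ∀ x y z u v → x * y * (z * (u * v)) ≡ z * ((u * y) * (v * x))
  regroup₁ = solve-∀
  regroup₂ : ∀ a A b B → a * (b * A) + A * (B * a) ≡ a * A * (b + B)
  regroup₂ = solve-∀
  regroup₃ : ∀ x y z u v → x * y * (z * u) * v ≡ y * z * (x * u * v)
  regroup₃ = solve-∀

log-sum : ∀ {k} (a b : Fin k → ℕ) → ∑ a ^ ∑ a * ∏ (λ c → b c ^ a c) ≤ ∑ b ^ ∑ a * ∏ (λ c → a c ^ a c)
log-sum {zero}  a b = ≤-refl
log-sum {suc k} a b = *-cancelˡ-≤ (A ^ A) {{n^n≢0 A}} (begin
  A ^ A * (N ^ N * (b₀ ^ a₀ * πb))      ≡⟨ regroup₁ (A ^ A) (N ^ N) (b₀ ^ a₀) πb ⟩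
  N ^ N * b₀ ^ a₀ * (A ^ A * πb)        ≤⟨ *-monoʳ-≤ (N ^ N * b₀ ^ a₀) (log-sum (a ∘ fsuc) (b ∘ fsuc)) ⟩
  N ^ N * b₀ ^ a₀ * (B ^ A * πa)        ≡⟨ regroup₂ (N ^ N) (b₀ ^ a₀) (B ^ A) πa ⟩
  N ^ N * (b₀ ^ a₀ * B ^ A) * πa        ≤⟨ *-monoˡ-≤ πa (log-sum₂ a₀ A b₀ B) ⟩
  a₀ ^ a₀ * A ^ A * (b₀ + B) ^ N * πa   ≡⟨ regroup₃ (a₀ ^ a₀) (A ^ A) ((b₀ + B) ^ N) πa ⟩
  A ^ A * ((b₀ + B) ^ N * (a₀ ^ a₀ * πa)) ∎)
  where
  open ≤-Reasoning
  a₀ = a fzero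
  b₀ = b fzero
  A = ∑ (a ∘ fsuc)
  B = ∑ (b ∘ fsuc)
  N = a₀ + A
  πa = ∏ (λ c → a (fsuc c) ^ a (fsuc c))
  πb = ∏ (λ c → b (fsuc c) ^ a (fsuc c))
  regroup₁ : ∀ x y z u → x * (y * (z * u)) ≡ y * z * (x * u)
  regroup₁ = solve-∀
  regroup₂ : ∀ x y z u → x * y * (z * u) ≡ x * (y * z) * u
  regroup₂ = solve-∀
  regroup₃ : ∀ x y z u → x * y * z * u ≡ y * (z * (x * u))
  regroup₃ = solve-∀

count-++ : ∀ {k} (c : Fin k) xs ys → count c (xs ++ ys) ≡ count c xs + count c ys
count-++ c xs ys = trans (cong length (filter-++ (c ≟_) xs ys)) (length-++ (filter (c ≟_) xs))

count-fsuc-singleton : ∀ {k} (c x : Fin k) → count (fsuc c) [ fsuc x ] ≡ count c [ x ]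
count-fsuc-singleton c x with c ≟ x
... | yes _ = refl
... | no  _ = refl

∑-count-singleton : ∀ {k} (x : Fin k) → ∑ (λ c → count c [ x ]) ≡ 1
∑-count-singleton {suc k} fzero = cong suc (sum-replicate-zero k)
∑-count-singleton (fsuc x)      = trans (sum-cong-≗ (λ c → count-fsuc-singleton c x)) (∑-count-singleton x)

∏-pow-count-singleton : ∀ {k} (f : Fin k → ℕ) (x : Fin k) → ∏ (λ c → f c ^ count c [ x ]) ≡ f x
∏-pow-count-singleton {suc k} f fzero =
  trans (cong₂ _*_ (*-identityʳ (f fzero)) (∏-replicate-one k)) (*-identityʳ (f fzero))
∏-pow-count-singleton f (fsuc x)      = trans (+-identityʳ _)
  (trans (∏-cong-≗ (λ c → cong (f (fsuc c) ^_) (count-fsuc-singleton c x))) (∏-pow-count-singleton (f ∘ fsuc) x))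

∑-count : ∀ {k} (X : List (Fin k)) → ∑ (λ c → count c X) ≡ length X
∑-count {k} []  = sum-replicate-zero k
∑-count (x ∷ X) = begin
  ∑ (λ c → count c (x ∷ X))                      ≡⟨ sum-cong-≗ (λ c → count-++ c [ x ] X) ⟩
  ∑ (λ c → count c [ x ] + count c X)            ≡⟨ ∑-distrib-+ (λ c → count c [ x ]) (λ c → count c X) ⟩
  ∑ (λ c → count c [ x ]) + ∑ (λ c → count c X)  ≡⟨ cong₂ _+_ (∑-count-singleton x) (∑-count X) ⟩
  suc (length X)                                 ∎
  where open ≡-Reasoning

∏-pow-count : ∀ {k} (f : Fin k → ℕ) (X : List (Fin k)) → ∏ (λ c → f c ^ count c X) ≡ product (map f X)
∏-pow-count {k} f []  = ∏-replicate-one k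
∏-pow-count f (x ∷ X) = begin
  ∏ (λ c → f c ^ count c (x ∷ X))
    ≡⟨ ∏-cong-≗ split ⟩
  ∏ (λ c → f c ^ count c [ x ] * f c ^ count c X)
    ≡⟨ ∏-distrib-* (λ c → f c ^ count c [ x ]) (λ c → f c ^ count c X) ⟩
  ∏ (λ c → f c ^ count c [ x ]) * ∏ (λ c → f c ^ count c X)
    ≡⟨ cong₂ _*_ (∏-pow-count-singleton f x) (∏-pow-count f X) ⟩
  f x * product (map f X)
    ∎
  where
  open ≡-Reasoning
  split : ∀ c → f c ^ count c (x ∷ X) ≡ f c ^ count c [ x ] * f c ^ count c X
  split c = trans (cong (f c ^_) (count-++ c [ x ] X)) (^-distribˡ-+-* (f c) (count c [ x ]) (count c X))

product-tabulate : ∀ {k} (f : Fin k → ℕ) → product (tabulate f) ≡ ∏ f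
product-tabulate {zero}  f = refl
product-tabulate {suc k} f = cong (f fzero *_) (product-tabulate (f ∘ fsuc))

powProd≡∏ : ∀ {k} (X : List (Fin k)) → powProd X ≡ ∏ (λ c → count c X ^ count c X)
powProd≡∏ X = trans (cong product (map-tabulate id g)) (product-tabulate g)
  where
  g : Fin _ → ℕ
  g c = count c X ^ count c X

powProd≡product-count : ∀ {k} (X : List (Fin k)) → powProd X ≡ product (map (λ c → count c X) X)
powProd≡product-count X = trans (powProd≡∏ X) (∏-pow-count (λ c → count c X) X)

powProd>0 : ∀ {k} (X : List (Fin k)) → 0 < powProd X
powProd>0 {k} X =
  >-nonZero⁻¹ (powProd X) {{product≢0 (All-map⁺ (All.universal (λ c → n^n≢0 (count c X)) (allFin k)))}}

-- Exponentiated form of  |X| H₀ᵖᶜ(X) ≤ − Σ_{x ∈ X} log₂ (|Z|ₓ / |Z|).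
entropy≤crossEntropy : ∀ {k} (X Z : List (Fin k)) →
  length X ^ length X * product (map (λ c → count c Z) X) ≤ length Z ^ length X * powProd X
entropy≤crossEntropy X Z = begin
  length X ^ length X * product (map b X)
    ≡⟨ cong₂ _*_ (cong₂ _^_ (∑-count X) (∑-count X)) (∏-pow-count b X) ⟨
  ∑ a ^ ∑ a * ∏ (λ c → b c ^ a c)
    ≤⟨ log-sum a b ⟩
  ∑ b ^ ∑ a * ∏ (λ c → a c ^ a c)
    ≡⟨ cong₂ _*_ (cong₂ _^_ (∑-count Z) (∑-count X)) (sym (powProd≡∏ X)) ⟩
  length Z ^ length X * powProd X
    ∎
  where
  open ≤-Reasoning
  a b : Fin _ → ℕ
  a c = count c X
  b c = count c Z

^length≤product : ∀ {m ns} → All (m ≤_) ns → m ^ length ns ≤ product ns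
^length≤product []           = ≤-refl
^length≤product (m≤n ∷ m≤ns) = *-mono-≤ m≤n (^length≤product m≤ns)

removeMin-geometricMean : ∀ {m ns} → All (m ≤_) ns → (m * product ns) ^ length ns ≤ product ns ^ suc (length ns)
removeMin-geometricMean {m} {ns} m≤ns = begin
  (m * product ns) ^ length ns             ≡⟨ ^-distribʳ-* m (product ns) (length ns) ⟩
  m ^ length ns * product ns ^ length ns   ≤⟨ *-monoˡ-≤ (product ns ^ length ns) (^length≤product m≤ns) ⟩
  product ns * product ns ^ length ns      ∎
  where open ≤-Reasoning

product-map-++ : ∀ {A : Set} (f : A → ℕ) xs ys → product (map f (xs ++ ys)) ≡ product (map f xs) * product (map f ys)
product-map-++ f xs ys = trans (cong product (map-++ f xs ys)) (product-++ (map f xs) (map f ys))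

product-concat-^-mono : ∀ {A I : Set} (f : A → ℕ) (Xs Ys : I → List A) i j →
  (∀ t → product (map f (Xs t)) ^ i ≤ product (map f (Ys t)) ^ j) →
  ∀ ts → product (map f (concat (map Xs ts))) ^ i ≤ product (map f (concat (map Ys ts))) ^ j
product-concat-^-mono f Xs Ys i j h []       = ≤-reflexive (trans (^-zeroˡ i) (sym (^-zeroˡ j)))
product-concat-^-mono f Xs Ys i j h (t ∷ ts) = begin
  product (map f (Xs t ++ concat (map Xs ts))) ^ i  ≡⟨ cong (_^ i) (product-map-++ f (Xs t) _) ⟩
  (πX * πXs) ^ i                                    ≡⟨ ^-distribʳ-* πX πXs i ⟩
  πX ^ i * πXs ^ i                                  ≤⟨ *-mono-≤ (h t) (product-concat-^-mono f Xs Ys i j h ts) ⟩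
  πY ^ j * πYs ^ j                                  ≡⟨ ^-distribʳ-* πY πYs j ⟨
  (πY * πYs) ^ j                                    ≡⟨ cong (_^ j) (product-map-++ f (Ys t) _) ⟨
  product (map f (Ys t ++ concat (map Ys ts))) ^ j  ∎
  where
  open ≤-Reasoning
  πX = product (map f (Xs t))
  πY = product (map f (Ys t))
  πXs = product (map f (concat (map Xs ts)))
  πYs = product (map f (concat (map Ys ts)))

length-concat-map : ∀ {A I : Set} (Xs : I → List A) {K} → (∀ t → length (Xs t) ≡ K) →
  ∀ ts → length (concat (map Xs ts)) ≡ K * length ts
length-concat-map Xs {K} h []       = sym (*-zeroʳ K)
length-concat-map Xs {K} h (t ∷ ts) = begin
  length (Xs t ++ concat (map Xs ts))          ≡⟨ length-++ (Xs t) ⟩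
  length (Xs t) + length (concat (map Xs ts))  ≡⟨ cong₂ _+_ (h t) (length-concat-map Xs h ts) ⟩
  K + K * length ts                            ≡⟨ *-suc K (length ts) ⟨
  K * suc (length ts)                          ∎
  where open ≡-Reasoning

RespectsWeight : ∀ {k} → Permutation′ k → (Fin k → ℕ) → Set
RespectsWeight {k} σ b = (u v : Fin k) → b v < b u → toℕ (σ ⟨$⟩ʳ v) < toℕ (σ ⟨$⟩ʳ u)

module _ {k} (σ : Permutation′ k) where

  deleteMin-length : ∀ {X Y} → DeleteMin σ X Y → length X ≡ suc (length Y)
  deleteMin-length (w , _ , _ , P , S , refl , refl) = length-++-sucʳ P w S

  deleteMin-product : (b : Fin k → ℕ) → RespectsWeight σ b → ∀ {X Y} → DeleteMin σ X Y →
    product (map b X) ^ length Y ≤ product (map b Y) ^ length X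
  deleteMin-product b respects dm@(w , _ , σ-min , P , S , refl , refl) = begin
    product (map b (P ++ w ∷ S)) ^ length PS  ≡⟨ cong₂ _^_ product-shift (sym (length-map b PS)) ⟩
    (b w * πPS) ^ length (map b PS)           ≤⟨ removeMin-geometricMean (All-map⁺ w-min) ⟩
    πPS ^ suc (length (map b PS))             ≡⟨ cong (λ K → πPS ^ suc K) (length-map b PS) ⟩
    πPS ^ suc (length PS)                     ≡⟨ cong (πPS ^_) (deleteMin-length dm) ⟨
    πPS ^ length (P ++ w ∷ S)                 ∎
    where
    open ≤-Reasoning
    PS = P ++ S
    πPS = product (map b PS)
    product-shift : product (map b (P ++ w ∷ S)) ≡ b w * πPS
    product-shift = product-↭ (↭-map⁺ b (shift w P S))
    b-min : ∀ {x} → x ∈ P ++ w ∷ S → b w ≤ b x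
    b-min x∈X = ≮⇒≥ (λ bx<bw → <⇒≱ (respects w _ bx<bw) (σ-min _ x∈X))
    w-min : All (λ x → b w ≤ b x) PS
    w-min = All.tail (All-resp-↭ (shift w P S) (All.tabulate b-min))

module _ {k n M} (σ : Permutation′ k) {Xs Ys : Fin n → List (Fin k)}
         (|Xs|≡M : ∀ t → length (Xs t) ≡ M) (deleteMin : ∀ t → DeleteMin σ (Xs t) (Ys t)) where

  private
    |Ys|≡M∸1 : ∀ t → length (Ys t) ≡ M ∸ 1
    |Ys|≡M∸1 t = cong (_∸ 1) (trans (sym (deleteMin-length σ (deleteMin t))) (|Xs|≡M t))

    length-concat-Xs : length (concat (map Xs (allFin n))) ≡ M * n
    length-concat-Xs = trans (length-concat-map Xs |Xs|≡M (allFin n)) (cong (M *_) (length-tabulate id))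

    length-concat-Ys : length (concat (map Ys (allFin n))) ≡ (M ∸ 1) * n
    length-concat-Ys = trans (length-concat-map Ys |Ys|≡M∸1 (allFin n)) (cong ((M ∸ 1) *_) (length-tabulate id))

  length-concat-deleteMin-≤ : length (concat (map Ys (allFin n))) ≤ length (concat (map Xs (allFin n)))
  length-concat-deleteMin-≤ = subst₂ _≤_ (sym length-concat-Ys) (sym length-concat-Xs) (*-monoˡ-≤ n (m∸n≤m M 1))

  product-concat-deleteMin : (b : Fin k → ℕ) → RespectsWeight σ b →
    let A = concat (map Xs (allFin n)); A′ = concat (map Ys (allFin n)) in
    product (map b A) ^ length A′ ≤ product (map b A′) ^ length A
  product-concat-deleteMin b respects = begin
    πA ^ length (concat (map Ys (allFin n)))  ≡⟨ cong (πA ^_) length-concat-Ys ⟩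
    πA ^ ((M ∸ 1) * n)                        ≡⟨ ^-*-assoc πA (M ∸ 1) n ⟨
    (πA ^ (M ∸ 1)) ^ n                        ≤⟨ ^-monoˡ-≤ n blocks ⟩
    (πA′ ^ M) ^ n                             ≡⟨ ^-*-assoc πA′ M n ⟩
    πA′ ^ (M * n)                             ≡⟨ cong (πA′ ^_) length-concat-Xs ⟨
    πA′ ^ length (concat (map Xs (allFin n))) ∎
    where
    open ≤-Reasoning
    πA = product (map b (concat (map Xs (allFin n))))
    πA′ = product (map b (concat (map Ys (allFin n))))
    block : ∀ t → product (map b (Xs t)) ^ (M ∸ 1) ≤ product (map b (Ys t)) ^ M
    block t = subst₂ (λ i j → product (map b (Xs t)) ^ i ≤ product (map b (Ys t)) ^ j)
      (|Ys|≡M∸1 t) (|Xs|≡M t) (deleteMin-product σ b respects (deleteMin t))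
    blocks : πA ^ (M ∸ 1) ≤ πA′ ^ M
    blocks = product-concat-^-mono b Xs Ys (M ∸ 1) M block (allFin n)

HpcLe′-intro : ∀ {N PX L PY} Q → N ≤ L → 0 < PX →
  N ^ N * Q ≤ L ^ N * PX → PY ^ N ≤ Q ^ L → HpcLe′ N PX L PY
HpcLe′-intro {L = zero} Q z≤n PX>0 _ _ = PX>0
HpcLe′-intro {N} {PX} {L@(suc _)} {PY} Q _ _ entropy blocks = begin
  N ^ (N * L) * PY ^ N   ≤⟨ *-monoʳ-≤ (N ^ (N * L)) blocks ⟩
  N ^ (N * L) * Q ^ L    ≡⟨ cong (_* Q ^ L) (^-*-assoc N N L) ⟨
  (N ^ N) ^ L * Q ^ L    ≡⟨ ^-distribʳ-* (N ^ N) Q L ⟨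
  (N ^ N * Q) ^ L        ≤⟨ ^-monoˡ-≤ L entropy ⟩
  (L ^ N * PX) ^ L       ≡⟨ ^-distribʳ-* (L ^ N) PX L ⟩
  (L ^ N) ^ L * PX ^ L   ≡⟨ cong (_* PX ^ L) (^-*-assoc L N L) ⟩
  L ^ (N * L) * PX ^ L   ∎
  where open ≤-Reasoning

lemma6 : (n M : ℕ) (out : Blocks n M) → Acyclic out →
    (σ : Permutation′ (suc n)) → Respects out σ →
    (Y : Fin n → List (Fin (suc n))) →
    ((t : Fin n) → DeleteMin σ (toList (out t)) (Y t)) →
    HpcLe (concat (map Y (allFin n))) (adjString out)
lemma6 n M out _ σ respects Y deleteMin =
  HpcLe′-intro Q (length-concat-deleteMin-≤ σ |X|≡M deleteMin) (powProd>0 A′)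
    (entropy≤crossEntropy A′ A) geometricMeans
  where
  A = adjString out
  A′ = concat (map Y (allFin n))
  Q = product (map (indeg out) A′)
  |X|≡M : ∀ t → length (toList (out t)) ≡ M
  |X|≡M t = length-toList (out t)
  geometricMeans : powProd A ^ length A′ ≤ Q ^ length A
  geometricMeans rewrite powProd≡product-count A = product-concat-deleteMin σ |X|≡M deleteMin (indeg out) respects
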